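{- Let $n\ge 1$ and $N=\binom{n+1}{2}$ (i.e. $N=\binom{n}{2}+m$ with $m=n$). Then $F(N)=n\binom{n+1}{2}$.
   Context: All graphs are finite and simple. For a graph $G$, $S(G)=\sum_{uv\in E(G)}\min(\deg u,\deg v)$. For an integer $N\ge 1$, $F(N)$ is the maximum of $S(G)$ over all graphs $G$ with exactly $N$ edges. -}

module Defs where

open import Data.Nat using (ℕ; _+_; _⊓_; _≤_)
open import Data.Fin as Fin using (Fin)
open import Data.Bool using (if_then_else_; _∨_)
open import Data.Product using (_×_; proj₁; proj₂; Σ)
open import Data.List using (List; length; map)
open import Data.Nat.ListAction using (sum)
open import Data.List.Relation.Unary.All using (All)
open import Data.List.Relation.Unary.Unique.Propositional using (Unique)
open import Relation.Nullary.Decidable using (⌊_⌋)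
open import Relation.Binary.PropositionalEquality using (_≡_)

-- A finite simple graph on vertex set Fin V: a duplicate-free list of
-- edges, each edge stored as an ordered pair (u , v) with u < v
-- (so no loops, and each unordered edge has exactly one representation).
record Graph : Set where
  field
    V       : ℕ
    edges   : List (Fin V × Fin V)
    ordered : All (λ e → proj₁ e Fin.< proj₂ e) edges
    unique  : Unique edges

open Graph public

numEdges : Graph → ℕ
numEdges G = length (edges G)

deg : (G : Graph) → Fin (V G) → ℕ
deg G v = sum (map (λ e → if ⌊ proj₁ e Fin.≟ v ⌋ ∨ ⌊ proj₂ e Fin.≟ v ⌋ then 1 else 0) (edges G))

S : Graph → ℕ
S G = sum (map (λ e → deg G (proj₁ e) ⊓ deg G (proj₂ e)) (edges G))

-- "F(N) = k": k is the maximum of S(G) over all graphs with exactly N edges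
FEq : ℕ → ℕ → Set
FEq N k = ((G : Graph) → numEdges G ≡ N → S G ≤ k)
        × Σ Graph (λ G → numEdges G ≡ N × S G ≡ k)

-- Write min (deg u) (deg v) as the number of levels k < N below it.  Then S(G) = Σ_k E_k,
-- where E_k counts the edges between vertices of degree > k, while Σ_k T_k = Σ_v deg v = 2N,
-- where T_k counts those vertices.  The E_k edges live on T_k vertices, so
-- 2 E_k ≤ T_k (T_k - 1), and also E_k ≤ N.  When 2N ≤ n (n + 1) the first bound gives
-- 2 E_k ≤ n T_k if T_k ≤ n + 1 and the second gives it otherwise; summing over k yields
-- S(G) ≤ n N.  The complete graph on n + 1 vertices, which is n-regular, attains the bound.
module Submission where

open import Defs
open import Data.Nat using (ℕ; zero; suc; _+_; _*_; _∸_; _⊓_; _<ᵇ_; _≤_; _≤?_; z≤n; s≤s)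
open import Data.Nat.Combinatorics using (_C_; nC1≡n; nCk+nC[k+1]≡[n+1]C[k+1])

open import Algebra.Properties.CommutativeSemigroup using (interchange; x∙yz≈y∙xz)
open import Data.Bool using (Bool; true; false; _∧_; _∨_; not; if_then_else_)
open import Data.Bool.Properties using (∧-identityʳ; ∧-zeroʳ)
open import Data.Fin as Fin using (Fin; _≟_)
open import Data.Fin.Properties using (suc-injective; <⇒≢; <-asym)
open import Data.List using (List; []; _∷_; _++_; length; map; allFin; downFrom)
open import Data.List.Membership.Propositional using (_∈_)
open import Data.List.Membership.Propositional.Properties using (∈-map⁻)
open import Data.List.Properties using (map-cong; map-cong-local; map-++; map-∘; map-tabulate; length-++; length-map; length-tabulate)
open import Data.List.Relation.Unary.All as All using (All; []; _∷_)
import Data.List.Relation.Unary.All.Properties as All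
open import Data.List.Relation.Unary.AllPairs using ([]; _∷_)
open import Data.List.Relation.Unary.Any using (here; there)
open import Data.List.Relation.Unary.Unique.Propositional using (Unique)
import Data.List.Relation.Unary.Unique.Propositional.Properties as Unique
open import Data.Nat.ListAction using (sum)
open import Data.Nat.ListAction.Properties using (sum-++)
open import Data.Nat.Properties
  using ( ≤-refl; ≤-reflexive; ≤-trans; <⇒≤; ≰⇒>; module ≤-Reasoning
        ; +-identityʳ; +-suc; +-mono-≤; +-commutativeSemigroup
        ; *-comm; *-identityˡ; *-zeroʳ; *-suc; *-distribˡ-+; *-distribʳ-+; *-commutativeSemigroup
        ; *-monoʳ-≤; *-cancelˡ-≤; ∸-monoˡ-≤; ⊓-zeroʳ; ⊓-idem; m⊓n≤m; m≥n⇒m⊓n≡n )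
open import Data.Empty using (⊥-elim)
open import Data.Product using (_×_; _,_; proj₁; proj₂)
open import Function using (_∘_; id; mk⇔)
open import Relation.Nullary using (¬_; yes; no)
open import Relation.Nullary.Decidable using (⌊_⌋; isYes≗does; dec-false; does-⇔; ⌊⌋-map′)
open import Relation.Binary.PropositionalEquality hiding ([_])

private variable
  A : Set
  m : ℕ

-- Written with if_then_else_ so that deg G v is definitionally count (incident v) (edges G).
[_] : Bool → ℕ
[ b ] = if b then 1 else 0

∑-syntax : List A → (A → ℕ) → ℕ
∑-syntax xs f = sum (map f xs)

syntax ∑-syntax xs (λ x → e) = ∑[ x ∈ xs ] e

count : (A → Bool) → List A → ℕ
count p xs = ∑[ x ∈ xs ] [ p x ]

∑-cong : {f g : A → ℕ} → (∀ x → f x ≡ g x) → ∀ xs → ∑[ x ∈ xs ] f x ≡ ∑[ x ∈ xs ] g x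
∑-cong f≗g xs = cong sum (map-cong f≗g xs)

∑-cong-local : {f g : A → ℕ} {xs : List A} → All (λ x → f x ≡ g x) xs → ∑[ x ∈ xs ] f x ≡ ∑[ x ∈ xs ] g x
∑-cong-local f≗g = cong sum (map-cong-local f≗g)

∑-mono : {f g : A → ℕ} → (∀ x → f x ≤ g x) → ∀ xs → ∑[ x ∈ xs ] f x ≤ ∑[ x ∈ xs ] g x
∑-mono f≤g []       = z≤n
∑-mono f≤g (x ∷ xs) = +-mono-≤ (f≤g x) (∑-mono f≤g xs)

∑-const : ∀ c (xs : List A) → ∑[ x ∈ xs ] c ≡ c * length xs
∑-const c []       = sym (*-zeroʳ c)
∑-const c (x ∷ xs) = trans (cong (c +_) (∑-const c xs)) (sym (*-suc c (length xs)))

∑-distrib-+ : ∀ (f g : A → ℕ) xs → ∑[ x ∈ xs ] (f x + g x) ≡ ∑[ x ∈ xs ] f x + ∑[ x ∈ xs ] g x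
∑-distrib-+ f g []       = refl
∑-distrib-+ f g (x ∷ xs) =
  trans (cong (f x + g x +_) (∑-distrib-+ f g xs)) (interchange +-commutativeSemigroup (f x) (g x) _ _)

*-distribˡ-∑ : ∀ c (f : A → ℕ) xs → c * ∑[ x ∈ xs ] f x ≡ ∑[ x ∈ xs ] (c * f x)
*-distribˡ-∑ c f []       = *-zeroʳ c
*-distribˡ-∑ c f (x ∷ xs) = trans (*-distribˡ-+ c (f x) _) (cong (c * f x +_) (*-distribˡ-∑ c f xs))

∑-comm : ∀ {B : Set} (f : A → B → ℕ) xs ys →
         ∑[ x ∈ xs ] ∑[ y ∈ ys ] f x y ≡ ∑[ y ∈ ys ] ∑[ x ∈ xs ] f x y
∑-comm f []       ys = sym (∑-const 0 ys)
∑-comm f (x ∷ xs) ys =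
  trans (cong (∑[ y ∈ ys ] f x y +_) (∑-comm f xs ys)) (sym (∑-distrib-+ (f x) _ ys))

∑-++ : ∀ (f : A → ℕ) xs ys → ∑[ x ∈ xs ++ ys ] f x ≡ ∑[ x ∈ xs ] f x + ∑[ x ∈ ys ] f x
∑-++ f xs ys = trans (cong sum (map-++ f xs ys)) (sum-++ (map f xs) (map f ys))

∑-map : ∀ {B : Set} (f : B → ℕ) (g : A → B) xs → ∑[ y ∈ map g xs ] f y ≡ ∑[ x ∈ xs ] f (g x)
∑-map f g xs = cong sum (sym (map-∘ xs))

count-≤-length : ∀ (p : A → Bool) xs → count p xs ≤ length xs
count-≤-length p xs = ≤-trans (∑-mono [p]≤1 xs) (≤-reflexive (trans (∑-const 1 xs) (*-identityˡ _)))
  where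
  [p]≤1 : ∀ x → [ p x ] ≤ 1
  [p]≤1 x with p x
  ... | true  = ≤-refl
  ... | false = z≤n

[∧]≡[]*[] : ∀ a b → [ a ∧ b ] ≡ [ a ] * [ b ]
[∧]≡[]*[] true  b = sym (+-identityʳ [ b ])
[∧]≡[]*[] false b = refl

∧≡true : ∀ a {b} → a ∧ b ≡ true → a ≡ true × b ≡ true
∧≡true true b≡true = refl , b≡true

∑-allFin-suc : ∀ (f : Fin (suc m) → ℕ) →
               ∑[ v ∈ allFin (suc m) ] f v ≡ f Fin.zero + ∑[ v ∈ allFin m ] f (Fin.suc v)
∑-allFin-suc f =
  cong (λ ys → f Fin.zero + sum ys) (trans (map-tabulate _ f) (sym (map-tabulate id (f ∘ Fin.suc))))

≟-sym : (a b : Fin m) → ⌊ a ≟ b ⌋ ≡ ⌊ b ≟ a ⌋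
≟-sym a b =
  trans (isYes≗does (a ≟ b)) (trans (does-⇔ (mk⇔ sym sym) (a ≟ b) (b ≟ a)) (sym (isYes≗does (b ≟ a))))

≟-suc : (a b : Fin m) → ⌊ Fin.suc a ≟ Fin.suc b ⌋ ≡ ⌊ a ≟ b ⌋
≟-suc a b = ⌊⌋-map′ _ _ (a ≟ b)

≢⇒≟≡false : {a b : Fin m} → a ≢ b → ⌊ a ≟ b ⌋ ≡ false
≢⇒≟≡false {a = a} {b} a≢b = trans (isYes≗does (a ≟ b)) (dec-false (a ≟ b) a≢b)

count-≟ : (a : Fin m) → count (λ v → ⌊ a ≟ v ⌋) (allFin m) ≡ 1
count-≟ {suc m} Fin.zero    =
  trans (∑-allFin-suc {m} (λ v → [ ⌊ Fin.zero ≟ v ⌋ ])) (cong suc (∑-const 0 (allFin m)))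
count-≟ {suc m} (Fin.suc a) =
  trans (∑-allFin-suc {m} (λ v → [ ⌊ Fin.suc a ≟ v ⌋ ]))
        (trans (∑-cong (cong [_] ∘ ≟-suc a) (allFin m)) (count-≟ a))

count-≟ʳ : (a : Fin m) → count (λ v → ⌊ v ≟ a ⌋) (allFin m) ≡ 1
count-≟ʳ a = trans (∑-cong (λ v → cong [_] (≟-sym v a)) (allFin _)) (count-≟ a)

count-pair : {a b : Fin m} → a ≢ b → count (λ v → ⌊ a ≟ v ⌋ ∨ ⌊ b ≟ v ⌋) (allFin m) ≡ 2
count-pair {m} {a} {b} a≢b = begin
  count (λ v → ⌊ a ≟ v ⌋ ∨ ⌊ b ≟ v ⌋) (allFin m)
    ≡⟨ ∑-cong [∨]≡[]+[] (allFin m) ⟩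
  ∑[ v ∈ allFin m ] ([ ⌊ a ≟ v ⌋ ] + [ ⌊ b ≟ v ⌋ ])
    ≡⟨ ∑-distrib-+ _ _ (allFin m) ⟩
  count (λ v → ⌊ a ≟ v ⌋) (allFin m) + count (λ v → ⌊ b ≟ v ⌋) (allFin m)
    ≡⟨ cong₂ _+_ (count-≟ a) (count-≟ b) ⟩
  2 ∎
  where
  open ≡-Reasoning
  [∨]≡[]+[] : ∀ v → [ ⌊ a ≟ v ⌋ ∨ ⌊ b ≟ v ⌋ ] ≡ [ ⌊ a ≟ v ⌋ ] + [ ⌊ b ≟ v ⌋ ]
  [∨]≡[]+[] v with a ≟ v
  ... | no _     = refl
  ... | yes refl rewrite ≢⇒≟≡false (a≢b ∘ sym) = refl

count-remove : ∀ (Q : Fin m → Bool) {o} → Q o ≡ true →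
               count Q (allFin m) ≡ suc (count (λ w → Q w ∧ not ⌊ o ≟ w ⌋) (allFin m))
count-remove {m} Q {o} Qo = begin
  count Q (allFin m)                                        ≡⟨ ∑-cong split (allFin m) ⟩
  ∑[ w ∈ allFin m ] ([ ⌊ o ≟ w ⌋ ] + [ Q w ∧ not ⌊ o ≟ w ⌋ ]) ≡⟨ ∑-distrib-+ _ _ (allFin m) ⟩
  count (λ w → ⌊ o ≟ w ⌋) (allFin m) + rest                 ≡⟨ cong (_+ rest) (count-≟ o) ⟩
  suc rest                                                  ∎
  where
  open ≡-Reasoning
  rest : ℕ
  rest = count (λ w → Q w ∧ not ⌊ o ≟ w ⌋) (allFin m)
  split : ∀ w → [ Q w ] ≡ [ ⌊ o ≟ w ⌋ ] + [ Q w ∧ not ⌊ o ≟ w ⌋ ]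
  split w with o ≟ w
  ... | yes refl rewrite Qo = refl
  ... | no _     = cong [_] (sym (∧-identityʳ (Q w)))

pigeonhole : ∀ {xs : List A} (p : A → Bool) (g : A → Fin m) (Q : Fin m → Bool) → Unique xs →
             (∀ {x y} → x ∈ xs → y ∈ xs → p x ≡ true → p y ≡ true → g x ≡ g y → x ≡ y) →
             (∀ {x} → x ∈ xs → p x ≡ true → Q (g x) ≡ true) →
             count p xs ≤ count Q (allFin m)
pigeonhole p g Q [] injective maps-into = z≤n
pigeonhole {m = m} {xs = x ∷ xs} p g Q (x∉xs ∷ unique) injective maps-into with p x in px
... | false = pigeonhole p g Q unique (λ x∈ y∈ → injective (there x∈) (there y∈)) (maps-into ∘ there)
... | true  = begin
  suc (count p xs)          ≤⟨ s≤s (pigeonhole p g Q′ unique (λ x∈ y∈ → injective (there x∈) (there y∈)) maps-into′) ⟩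
  suc (count Q′ (allFin m)) ≡⟨ count-remove Q (maps-into (here refl) px) ⟨
  count Q (allFin m)        ∎
  where
  open ≤-Reasoning
  Q′ : Fin m → Bool
  Q′ w = Q w ∧ not ⌊ g x ≟ w ⌋
  maps-into′ : ∀ {y} → y ∈ xs → p y ≡ true → Q′ (g y) ≡ true
  maps-into′ {y} y∈ py rewrite maps-into (there y∈) py
                             | ≢⇒≟≡false (All.lookup x∉xs y∈ ∘ injective (here refl) (there y∈) px py) = refl

[<ᵇ]+⊓ : ∀ M d → [ M <ᵇ d ] + M ⊓ d ≡ suc M ⊓ d
[<ᵇ]+⊓ M       zero    = ⊓-zeroʳ M
[<ᵇ]+⊓ zero    (suc d) = refl
[<ᵇ]+⊓ (suc M) (suc d) = trans (+-suc [ M <ᵇ d ] (M ⊓ d)) (cong suc ([<ᵇ]+⊓ M d))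

∑-<ᵇ : ∀ M d → ∑[ k ∈ downFrom M ] [ k <ᵇ d ] ≡ M ⊓ d
∑-<ᵇ zero    d = refl
∑-<ᵇ (suc M) d = trans (cong ([ M <ᵇ d ] +_) (∑-<ᵇ M d)) ([<ᵇ]+⊓ M d)

layer-cake : ∀ {d M} → d ≤ M → ∑[ k ∈ downFrom M ] [ k <ᵇ d ] ≡ d
layer-cake {d} {M} d≤M = trans (∑-<ᵇ M d) (m≥n⇒m⊓n≡n d≤M)

<ᵇ-⊓ : ∀ k a b → (k <ᵇ a ⊓ b) ≡ (k <ᵇ a) ∧ (k <ᵇ b)
<ᵇ-⊓ k       zero    b       = refl
<ᵇ-⊓ k       (suc a) zero    = sym (∧-zeroʳ _)
<ᵇ-⊓ zero    (suc a) (suc b) = refl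
<ᵇ-⊓ (suc k) (suc a) (suc b) = <ᵇ-⊓ k a b

level-bound : ∀ n t {N e} → 2 * N ≤ n * suc n → e ≤ N → 2 * e ≤ t * (t ∸ 1) → 2 * e ≤ n * t
level-bound n t {N} {e} 2N≤n[n+1] e≤N 2e≤t[t-1] with t ≤? suc n
... | yes t≤n+1 = begin
  2 * e       ≤⟨ 2e≤t[t-1] ⟩
  t * (t ∸ 1) ≤⟨ *-monoʳ-≤ t (∸-monoˡ-≤ 1 t≤n+1) ⟩
  t * n       ≡⟨ *-comm t n ⟩
  n * t       ∎
  where open ≤-Reasoning
... | no t≰n+1 = begin
  2 * e       ≤⟨ *-monoʳ-≤ 2 e≤N ⟩
  2 * N       ≤⟨ 2N≤n[n+1] ⟩
  n * suc n   ≤⟨ *-monoʳ-≤ n (<⇒≤ (≰⇒> t≰n+1)) ⟩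
  n * t       ∎
  where open ≤-Reasoning

Edge : ℕ → Set
Edge m = Fin m × Fin m

Ordered : Edge m → Set
Ordered e = proj₁ e Fin.< proj₂ e

incident : Fin m → Edge m → Bool
incident v e = ⌊ proj₁ e ≟ v ⌋ ∨ ⌊ proj₂ e ≟ v ⌋

other : Fin m → Edge m → Fin m
other v e = if ⌊ proj₁ e ≟ v ⌋ then proj₂ e else proj₁ e

within : (Fin m → Bool) → Edge m → Bool
within P e = P (proj₁ e) ∧ P (proj₂ e)

≟≡true⇒≡ : {a b : Fin m} → ⌊ a ≟ b ⌋ ≡ true → a ≡ b
≟≡true⇒≡ {a = a} {b} a≟b with a ≟ b
... | yes a≡b = a≡b

count-incident : {e : Edge m} → Ordered e → count (λ v → incident v e) (allFin m) ≡ 2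
count-incident a<b = count-pair (<⇒≢ a<b)

other-≢ : {v : Fin m} {e : Edge m} → Ordered e → incident v e ≡ true → other v e ≢ v
other-≢ {v = v} {a , b} a<b v∈e with a ≟ v
... | yes refl = <⇒≢ a<b ∘ sym
... | no _     = λ a≡v → <⇒≢ a<b (trans a≡v (sym (≟≡true⇒≡ v∈e)))

other-injective : {v : Fin m} {e e′ : Edge m} → Ordered e → Ordered e′ →
                  incident v e ≡ true → incident v e′ ≡ true → other v e ≡ other v e′ → e ≡ e′
other-injective {v = v} {a , b} {a′ , b′} a<b a′<b′ v∈e v∈e′ eq with a ≟ v | a′ ≟ v
... | yes refl | yes refl = cong (a ,_) eq
... | yes refl | no _     = ⊥-elim (<-asym a<b (subst₂ Fin._<_ (sym eq) (≟≡true⇒≡ v∈e′) a′<b′))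
... | no _     | yes refl = ⊥-elim (<-asym a′<b′ (subst₂ Fin._<_ eq (≟≡true⇒≡ v∈e) a<b))
... | no _     | no _     = cong₂ _,_ eq (trans (≟≡true⇒≡ v∈e) (sym (≟≡true⇒≡ v∈e′)))

within∧incident≤ : (P : Fin m → Bool) (v : Fin m) (e : Edge m) →
                   [ within P e ∧ incident v e ] ≤ [ P v ] * [ incident v e ∧ P (other v e) ]
within∧incident≤ P v (a , b) with a ≟ v | b ≟ v
... | yes refl | _        = ≤-reflexive (trans (cong [_] (∧-identityʳ _)) ([∧]≡[]*[] (P a) (P b)))
... | no _     | yes refl = ≤-reflexive (trans (cong [_] (∧-identityʳ _))
                                               (trans ([∧]≡[]*[] (P a) (P b)) (*-comm [ P a ] [ P b ])))
... | no _     | no _     = ≤-trans (≤-reflexive (cong [_] (∧-zeroʳ _))) z≤n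

vertices : (G : Graph) → List (Fin (V G))
vertices G = allFin (V G)

module _ (G : Graph) where

  count-neighbours-≤ : (P : Fin (V G) → Bool) (v : Fin (V G)) →
                       count (λ e → incident v e ∧ P (other v e)) (edges G)
                         ≤ count (λ w → P w ∧ not ⌊ v ≟ w ⌋) (vertices G)
  count-neighbours-≤ P v = pigeonhole _ (other v) _ (unique G) injective maps-into
    where
    injective : ∀ {e e′} → e ∈ edges G → e′ ∈ edges G →
                incident v e ∧ P (other v e) ≡ true → incident v e′ ∧ P (other v e′) ≡ true →
                other v e ≡ other v e′ → e ≡ e′
    injective {e} {e′} e∈ e′∈ pe pe′ =
      other-injective (All.lookup (ordered G) e∈) (All.lookup (ordered G) e′∈)
                      (proj₁ (∧≡true (incident v e) pe)) (proj₁ (∧≡true (incident v e′) pe′))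
    maps-into : ∀ {e} → e ∈ edges G → incident v e ∧ P (other v e) ≡ true →
                P (other v e) ∧ not ⌊ v ≟ other v e ⌋ ≡ true
    maps-into {e} e∈ pe with ∧≡true (incident v e) pe
    ... | v∈e , P[other] rewrite P[other] | ≢⇒≟≡false (other-≢ (All.lookup (ordered G) e∈) v∈e ∘ sym) = refl

  count-within-incident-≤ : (P : Fin (V G) → Bool) (v : Fin (V G)) →
                            count (λ e → within P e ∧ incident v e) (edges G)
                              ≤ (count P (vertices G) ∸ 1) * [ P v ]
  count-within-incident-≤ P v = begin
    count (λ e → within P e ∧ incident v e) (edges G)
      ≤⟨ ∑-mono (within∧incident≤ P v) (edges G) ⟩
    ∑[ e ∈ edges G ] ([ P v ] * [ incident v e ∧ P (other v e) ])
      ≡⟨ *-distribˡ-∑ [ P v ] _ (edges G) ⟨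
    [ P v ] * count (λ e → incident v e ∧ P (other v e)) (edges G)
      ≤⟨ *-monoʳ-≤ [ P v ] (count-neighbours-≤ P v) ⟩
    [ P v ] * count (λ w → P w ∧ not ⌊ v ≟ w ⌋) (vertices G)
      ≡⟨ without-v ⟩
    [ P v ] * (count P (vertices G) ∸ 1)
      ≡⟨ *-comm [ P v ] _ ⟩
    (count P (vertices G) ∸ 1) * [ P v ] ∎
    where
    open ≤-Reasoning
    without-v : [ P v ] * count (λ w → P w ∧ not ⌊ v ≟ w ⌋) (vertices G) ≡ [ P v ] * (count P (vertices G) ∸ 1)
    without-v with P v in Pv
    ... | true  = cong (λ c → 1 * (c ∸ 1)) (sym (count-remove P Pv))
    ... | false = refl

  count-within-≤ : (P : Fin (V G) → Bool) →
                   2 * count (within P) (edges G) ≤ count P (vertices G) * (count P (vertices G) ∸ 1)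
  count-within-≤ P = begin
    2 * count (within P) (edges G)                                        ≡⟨ *-distribˡ-∑ 2 _ (edges G) ⟩
    ∑[ e ∈ edges G ] (2 * [ within P e ])                                 ≡⟨ ∑-cong-local (All.map incidences (ordered G)) ⟩
    ∑[ e ∈ edges G ] ∑[ v ∈ vertices G ] [ within P e ∧ incident v e ]    ≡⟨ ∑-comm _ (edges G) (vertices G) ⟩
    ∑[ v ∈ vertices G ] count (λ e → within P e ∧ incident v e) (edges G) ≤⟨ ∑-mono (count-within-incident-≤ P) (vertices G) ⟩
    ∑[ v ∈ vertices G ] ((t ∸ 1) * [ P v ])                               ≡⟨ *-distribˡ-∑ (t ∸ 1) _ (vertices G) ⟨
    (t ∸ 1) * t                                                           ≡⟨ *-comm (t ∸ 1) t ⟩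
    t * (t ∸ 1)                                                           ∎
    where
    open ≤-Reasoning
    t : ℕ
    t = count P (vertices G)
    incidences : ∀ {e} → Ordered e → 2 * [ within P e ] ≡ ∑[ v ∈ vertices G ] [ within P e ∧ incident v e ]
    incidences {e} e-ordered = begin-equality
      2 * [ within P e ]                                      ≡⟨ *-comm 2 [ within P e ] ⟩
      [ within P e ] * 2                                      ≡⟨ cong ([ within P e ] *_) (count-incident e-ordered) ⟨
      [ within P e ] * count (λ v → incident v e) (vertices G) ≡⟨ *-distribˡ-∑ [ within P e ] _ (vertices G) ⟩
      ∑[ v ∈ vertices G ] ([ within P e ] * [ incident v e ])   ≡⟨ ∑-cong (λ v → [∧]≡[]*[] _ (incident v e)) (vertices G) ⟨
      ∑[ v ∈ vertices G ] [ within P e ∧ incident v e ]         ∎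

  ∑-deg : ∑[ v ∈ vertices G ] deg G v ≡ 2 * numEdges G
  ∑-deg = begin
    ∑[ v ∈ vertices G ] deg G v                              ≡⟨ ∑-comm (λ v e → [ incident v e ]) (vertices G) (edges G) ⟩
    ∑[ e ∈ edges G ] count (λ v → incident v e) (vertices G) ≡⟨ ∑-cong-local (All.map count-incident (ordered G)) ⟩
    ∑[ e ∈ edges G ] 2                                       ≡⟨ ∑-const 2 (edges G) ⟩
    2 * numEdges G                                           ∎
    where open ≡-Reasoning

  deg≤numEdges : (v : Fin (V G)) → deg G v ≤ numEdges G
  deg≤numEdges v = count-≤-length (incident v) (edges G)

  heavy : ℕ → Fin (V G) → Bool
  heavy k v = k <ᵇ deg G v

  S-layers : S G ≡ ∑[ k ∈ downFrom (numEdges G) ] count (within (heavy k)) (edges G)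
  S-layers = begin
    ∑[ e ∈ edges G ] (deg G (proj₁ e) ⊓ deg G (proj₂ e))
      ≡⟨ ∑-cong (λ e → layer-cake (≤-trans (m⊓n≤m _ _) (deg≤numEdges (proj₁ e)))) (edges G) ⟨
    ∑[ e ∈ edges G ] ∑[ k ∈ levels ] [ k <ᵇ deg G (proj₁ e) ⊓ deg G (proj₂ e) ]
      ≡⟨ ∑-comm _ (edges G) levels ⟩
    ∑[ k ∈ levels ] ∑[ e ∈ edges G ] [ k <ᵇ deg G (proj₁ e) ⊓ deg G (proj₂ e) ]
      ≡⟨ ∑-cong (λ k → ∑-cong (λ e → cong [_] (<ᵇ-⊓ k (deg G (proj₁ e)) (deg G (proj₂ e)))) (edges G)) levels ⟩
    ∑[ k ∈ levels ] count (within (heavy k)) (edges G) ∎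
    where
    open ≡-Reasoning
    levels : List ℕ
    levels = downFrom (numEdges G)

  ∑-count-heavy : ∑[ k ∈ downFrom (numEdges G) ] count (heavy k) (vertices G) ≡ 2 * numEdges G
  ∑-count-heavy = begin
    ∑[ k ∈ levels ] ∑[ v ∈ vertices G ] [ k <ᵇ deg G v ] ≡⟨ ∑-comm _ levels (vertices G) ⟩
    ∑[ v ∈ vertices G ] ∑[ k ∈ levels ] [ k <ᵇ deg G v ] ≡⟨ ∑-cong (λ v → layer-cake (deg≤numEdges v)) (vertices G) ⟩
    ∑[ v ∈ vertices G ] deg G v                          ≡⟨ ∑-deg ⟩
    2 * numEdges G                                       ∎
    where
    open ≡-Reasoning
    levels : List ℕ
    levels = downFrom (numEdges G)

  S≤n*numEdges : ∀ n → 2 * numEdges G ≤ n * suc n → S G ≤ n * numEdges G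
  S≤n*numEdges n 2N≤n[n+1] = *-cancelˡ-≤ 2 (begin
    2 * S G                   ≡⟨ cong (2 *_) S-layers ⟩
    2 * ∑[ k ∈ levels ] E k   ≡⟨ *-distribˡ-∑ 2 E levels ⟩
    ∑[ k ∈ levels ] (2 * E k) ≤⟨ ∑-mono per-level levels ⟩
    ∑[ k ∈ levels ] (n * T k) ≡⟨ *-distribˡ-∑ n T levels ⟨
    n * ∑[ k ∈ levels ] T k   ≡⟨ cong (n *_) ∑-count-heavy ⟩
    n * (2 * numEdges G)      ≡⟨ x∙yz≈y∙xz *-commutativeSemigroup n 2 (numEdges G) ⟩
    2 * (n * numEdges G)      ∎)
    where
    open ≤-Reasoning
    levels : List ℕ
    levels = downFrom (numEdges G)
    E T : ℕ → ℕ
    E k = count (within (heavy k)) (edges G)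
    T k = count (heavy k) (vertices G)
    per-level : ∀ k → 2 * E k ≤ n * T k
    per-level k = level-bound n (T k) 2N≤n[n+1] (count-≤-length _ (edges G)) (count-within-≤ (heavy k))

  S-regular : ∀ d → (∀ v → deg G v ≡ d) → S G ≡ d * numEdges G
  S-regular d deg≡d = begin
    ∑[ e ∈ edges G ] (deg G (proj₁ e) ⊓ deg G (proj₂ e)) ≡⟨ ∑-cong (λ e → cong₂ _⊓_ (deg≡d (proj₁ e)) (deg≡d (proj₂ e))) (edges G) ⟩
    ∑[ e ∈ edges G ] (d ⊓ d)                             ≡⟨ ∑-cong (λ _ → ⊓-idem d) (edges G) ⟩
    ∑[ e ∈ edges G ] d                                   ≡⟨ ∑-const d (edges G) ⟩
    d * numEdges G                                       ∎
    where open ≡-Reasoning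

star : Fin m → Edge (suc m)
star j = Fin.zero , Fin.suc j

shift : Edge m → Edge (suc m)
shift e = Fin.suc (proj₁ e) , Fin.suc (proj₂ e)

completeEdges : (m : ℕ) → List (Edge m)
completeEdges zero    = []
completeEdges (suc m) = map star (allFin m) ++ map shift (completeEdges m)

completeEdges-ordered : ∀ m → All Ordered (completeEdges m)
completeEdges-ordered zero    = []
completeEdges-ordered (suc m) =
  All.++⁺ (All.map⁺ (All.universal (λ _ → s≤s z≤n) (allFin m)))
          (All.map⁺ (All.map s≤s (completeEdges-ordered m)))

completeEdges-unique : ∀ m → Unique (completeEdges m)
completeEdges-unique zero    = []
completeEdges-unique (suc m) =
  Unique.++⁺ (Unique.map⁺ star-injective (Unique.allFin⁺ m))
             (Unique.map⁺ shift-injective (completeEdges-unique m))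
             disjoint
  where
  star-injective : ∀ {i j : Fin m} → star i ≡ star j → i ≡ j
  star-injective = suc-injective ∘ cong proj₂
  shift-injective : ∀ {e e′ : Edge m} → shift e ≡ shift e′ → e ≡ e′
  shift-injective eq = cong₂ _,_ (suc-injective (cong proj₁ eq)) (suc-injective (cong proj₂ eq))
  disjoint : ∀ {e} → ¬ (e ∈ map star (allFin m) × e ∈ map shift (completeEdges m))
  disjoint (e∈stars , e∈shifts) with ∈-map⁻ star e∈stars | ∈-map⁻ shift e∈shifts
  ... | _ , _ , refl | _ , _ , eq with () ← cong proj₁ eq

length-completeEdges : ∀ m → length (completeEdges m) ≡ m C 2
length-completeEdges zero    = refl
length-completeEdges (suc m) = begin
  length (map star (allFin m) ++ map shift (completeEdges m))          ≡⟨ length-++ (map star (allFin m)) ⟩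
  length (map star (allFin m)) + length (map shift (completeEdges m)) ≡⟨ cong₂ _+_ stars shifts ⟩
  m + m C 2                                                            ≡⟨ cong (_+ m C 2) (nC1≡n m) ⟨
  m C 1 + m C 2                                                        ≡⟨ nCk+nC[k+1]≡[n+1]C[k+1] m 1 ⟩
  suc m C 2                                                            ∎
  where
  open ≡-Reasoning
  stars : length (map star (allFin m)) ≡ m
  stars = trans (length-map star (allFin m)) (length-tabulate id)
  shifts : length (map shift (completeEdges m)) ≡ m C 2
  shifts = trans (length-map shift (completeEdges m)) (length-completeEdges m)

count-completeEdges-suc : ∀ m (p : Edge (suc m) → Bool) →
                          count p (completeEdges (suc m))
                            ≡ count (p ∘ star) (allFin m) + count (p ∘ shift) (completeEdges m)
count-completeEdges-suc m p =
  trans (∑-++ _ (map star (allFin m)) (map shift (completeEdges m)))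
        (cong₂ _+_ (∑-map _ star (allFin m)) (∑-map _ shift (completeEdges m)))

count-incident-complete : ∀ m (v : Fin (suc m)) → count (incident v) (completeEdges (suc m)) ≡ m
count-incident-complete m Fin.zero = begin
  count (incident Fin.zero) (completeEdges (suc m)) ≡⟨ count-completeEdges-suc m (incident Fin.zero) ⟩
  ∑[ j ∈ allFin m ] 1 + ∑[ e ∈ completeEdges m ] 0  ≡⟨ cong₂ _+_ (∑-const 1 (allFin m)) (∑-const 0 (completeEdges m)) ⟩
  1 * length (allFin m) + 0                         ≡⟨ trans (+-identityʳ _) (*-identityˡ _) ⟩
  length (allFin m)                                 ≡⟨ length-tabulate id ⟩
  m                                                 ∎
  where open ≡-Reasoning
count-incident-complete (suc m) (Fin.suc w) = begin
  count (incident (Fin.suc w)) (completeEdges (suc (suc m)))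
    ≡⟨ count-completeEdges-suc (suc m) (incident (Fin.suc w)) ⟩
  count (λ j → ⌊ Fin.suc j ≟ Fin.suc w ⌋) (allFin (suc m)) + count (incident (Fin.suc w) ∘ shift) (completeEdges (suc m))
    ≡⟨ cong₂ _+_ stars shifts ⟩
  1 + m ∎
  where
  open ≡-Reasoning
  stars : count (λ j → ⌊ Fin.suc j ≟ Fin.suc w ⌋) (allFin (suc m)) ≡ 1
  stars = trans (∑-cong (λ j → cong [_] (≟-suc j w)) (allFin (suc m))) (count-≟ʳ w)
  shifts : count (incident (Fin.suc w) ∘ shift) (completeEdges (suc m)) ≡ m
  shifts = trans (∑-cong (λ e → cong [_] (cong₂ _∨_ (≟-suc (proj₁ e) w) (≟-suc (proj₂ e) w))) (completeEdges (suc m)))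
                 (count-incident-complete m w)

complete : ℕ → Graph
complete m = record
  { V = m ; edges = completeEdges m ; ordered = completeEdges-ordered m ; unique = completeEdges-unique m }

2*[1+n]C2≡n*[1+n] : ∀ n → 2 * (suc n C 2) ≡ n * suc n
2*[1+n]C2≡n*[1+n] zero    = refl
2*[1+n]C2≡n*[1+n] (suc n) = begin
  2 * (suc (suc n) C 2)       ≡⟨ cong (2 *_) (nCk+nC[k+1]≡[n+1]C[k+1] (suc n) 1) ⟨
  2 * (suc n C 1 + suc n C 2) ≡⟨ cong (λ c → 2 * (c + suc n C 2)) (nC1≡n (suc n)) ⟩
  2 * (suc n + suc n C 2)     ≡⟨ *-distribˡ-+ 2 (suc n) _ ⟩
  2 * suc n + 2 * (suc n C 2) ≡⟨ cong (2 * suc n +_) (2*[1+n]C2≡n*[1+n] n) ⟩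
  2 * suc n + n * suc n       ≡⟨ *-distribʳ-+ (suc n) 2 n ⟨
  suc (suc n) * suc n         ≡⟨ *-comm (suc (suc n)) (suc n) ⟩
  suc n * suc (suc n)         ∎
  where open ≡-Reasoning

corollary1 : (n : ℕ) → 1 ≤ n → FEq ((suc n) C 2) (n * ((suc n) C 2))
corollary1 n _ = upper , K , length-completeEdges (suc n) , S-K
  where
  K : Graph
  K = complete (suc n)
  S-K : S K ≡ n * (suc n C 2)
  S-K = trans (S-regular K n (count-incident-complete n)) (cong (n *_) (length-completeEdges (suc n)))
  upper : (G : Graph) → numEdges G ≡ suc n C 2 → S G ≤ n * (suc n C 2)
  upper G N≡ = subst (λ N → S G ≤ n * N) N≡
                     (S≤n*numEdges G n (≤-reflexive (trans (cong (2 *_) N≡) (2*[1+n]C2≡n*[1+n] n))))
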